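{- Let $\mathbb{F}_4=\{0,1,\alpha,\alpha^2\}$ with $\alpha^2=\alpha+1$, $V=\mathbb{F}_4^{\,5}$, let $L$ be the line spanned by $(0,1,1,1,1)$ and $(1,0,1,\alpha,\alpha^2)$, let $P_j=L\cap C_j$, and let $H_1: x_2+x_3+x_4+x_5=0$, $H_2: x_1+x_3+\alpha^2x_4+\alpha x_5=0$, $H_3: x_1+x_2+\alpha x_4+\alpha^2x_5=0$, $H_4: x_1+\alpha^2x_2+\alpha x_3+x_5=0$, $H_5: x_1+\alpha x_2+\alpha^2x_3+x_4=0$. Let $L_1,\dots,L_6$ be the six simplex lines which intersect every $H_j\cap C_j$ ($j=1,\dots,5$) in a point distinct from $P_j$. Let $L'$ be a simplex line distinct from $L$ and not adjacent to $L$ in $\Gamma$ (so $L'$ meets each $H_j$ in a single point distinct from $P_j$), and let $n(L')$ be the number of indices $j\in\{1,\dots,5\}$ such that the point $L'\cap H_j$ is contained in $H_j\cap C_j$. If $L'$ is distinct from $L_1,\dots,L_6$, then $n(L')\in\{0,1,3\}$.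
   Context: $C_j=\{x\in V:x_j=0\}$. A vector of $V$ is a simplex vector if precisely one of its coordinates is zero. A point is a $1$-dimensional subspace; a simplex line is a $2$-dimensional subspace all of whose non-zero vectors are simplex vectors. $\Gamma$ is the graph whose vertices are all simplex lines, two distinct simplex lines being adjacent if their intersection is $1$-dimensional. -}

module Defs where

open import Data.Nat using (ℕ; zero; suc)
open import Data.Fin using (Fin)
open import Data.Vec using (Vec; []; _∷_; zipWith; map; replicate; lookup; foldr)
open import Data.Product using (Σ; ∃; ∃-syntax; _×_; _,_)
open import Relation.Binary.PropositionalEquality using (_≡_; _≢_)
open import Relation.Nullary using (¬_)

data F4 : Set where
  𝟎 𝟏 α α² : F4

infixl 6 _+F_
infixl 7 _*F_

_+F_ : F4 → F4 → F4
𝟎  +F y  = y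
x  +F 𝟎  = x
𝟏  +F 𝟏  = 𝟎
𝟏  +F α  = α²
𝟏  +F α² = α
α  +F 𝟏  = α²
α  +F α  = 𝟎
α  +F α² = 𝟏
α² +F 𝟏  = α
α² +F α  = 𝟏
α² +F α² = 𝟎

_*F_ : F4 → F4 → F4
𝟎  *F y  = 𝟎
𝟏  *F y  = y
α  *F 𝟎  = 𝟎
α  *F 𝟏  = α
α  *F α  = α²
α  *F α² = 𝟏
α² *F 𝟎  = 𝟎
α² *F 𝟏  = α²
α² *F α  = 𝟏
α² *F α² = α

-- V = F₄⁵ (coordinate x_{i+1} is at index i : Fin 5)

V : Set
V = Vec F4 5

0V : V
0V = replicate 5 𝟎

infixl 6 _⊕_
infixl 7 _•_

_⊕_ : V → V → V
_⊕_ = zipWith _+F_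

_•_ : F4 → V → V
c • v = map (c *F_) v

dot : ∀ {n} → Vec F4 n → Vec F4 n → F4
dot a x = foldr _ _+F_ 𝟎 (zipWith _*F_ a x)

Sub : Set₁
Sub = V → Set

_∩_ : Sub → Sub → Sub
(A ∩ B) x = A x × B x

_⊆_ : Sub → Sub → Set
A ⊆ B = ∀ x → A x → B x

SameSet : Sub → Sub → Set
SameSet A B = A ⊆ B × B ⊆ A

Span1 : V → Sub
Span1 p x = ∃[ c ] x ≡ c • p

Span2 : V → V → Sub
Span2 u v x = ∃[ a ] ∃[ b ] x ≡ a • u ⊕ b • v

IsPoint : Sub → Set
IsPoint A = ∃[ p ] (p ≢ 0V × SameSet A (Span1 p))

Independent : V → V → Set
Independent u v = ∀ a b → a • u ⊕ b • v ≡ 0V → (a ≡ 𝟎 × b ≡ 𝟎)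

numZeros : ∀ {n} → Vec F4 n → ℕ
numZeros [] = zero
numZeros (𝟎 ∷ xs) = suc (numZeros xs)
numZeros (𝟏 ∷ xs) = numZeros xs
numZeros (α ∷ xs) = numZeros xs
numZeros (α² ∷ xs) = numZeros xs

Simplex : V → Set
Simplex x = numZeros x ≡ 1

SimplexLine : V → V → Set
SimplexLine u v = Independent u v × (∀ x → (Span2 u v) x → x ≢ 0V → Simplex x)

Adjacent : Sub → Sub → Set
Adjacent M N = ¬ SameSet M N × IsPoint (M ∩ N)

C : Fin 5 → Sub
C j x = lookup x j ≡ 𝟎

l₁ l₂ : V
l₁ = 𝟎 ∷ 𝟏 ∷ 𝟏 ∷ 𝟏 ∷ 𝟏 ∷ []
l₂ = 𝟏 ∷ 𝟎 ∷ 𝟏 ∷ α ∷ α² ∷ []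

L : Sub
L = (Span2 l₁ l₂)

P : Fin 5 → Sub
P j = L ∩ C j

h : Fin 5 → V
h Fin.zero = 𝟎 ∷ 𝟏 ∷ 𝟏 ∷ 𝟏 ∷ 𝟏 ∷ []
h (Fin.suc Fin.zero) = 𝟏 ∷ 𝟎 ∷ 𝟏 ∷ α² ∷ α ∷ []
h (Fin.suc (Fin.suc Fin.zero)) = 𝟏 ∷ 𝟏 ∷ 𝟎 ∷ α ∷ α² ∷ []
h (Fin.suc (Fin.suc (Fin.suc Fin.zero))) = 𝟏 ∷ α² ∷ α ∷ 𝟎 ∷ 𝟏 ∷ []
h (Fin.suc (Fin.suc (Fin.suc (Fin.suc Fin.zero)))) = 𝟏 ∷ α ∷ α² ∷ 𝟏 ∷ 𝟎 ∷ []

H : Fin 5 → Sub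
H j x = dot (h j) x ≡ 𝟎

-- M is one of the lines L₁,…,L₆: for every j, M meets H_j ∩ C_j in a
-- point distinct from P_j
MeetsAllInNewPoints : Sub → Set
MeetsAllInNewPoints M =
  ∀ j → IsPoint (M ∩ (H j ∩ C j)) × ¬ SameSet (M ∩ (H j ∩ C j)) (P j)

-- Every simplex line M is spanned by vectors (0,1,a,b,c) and (1,0,d,e,f): some nonzero
-- vector of M vanishes at the first coordinate; being a simplex vector it does not vanish
-- at the second, so it rescales to (0,1,a,b,c), and symmetrically for (1,0,d,e,f).
-- Conversely every x ∈ M equals x₁(0,1,a,b,c) + x₀(1,0,d,e,f), because their difference
-- lies in M and has two zero coordinates. The notions in the statement only depend on M,
-- and for a line given by a spanning pair each of them is decidable by quantifying over
-- the 16 coefficient pairs, so the theorem reduces to evaluating a decision procedure on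
-- the 4⁶ normalised pairs.
module Submission where

open import Defs
open import Data.Fin using (Fin)
open import Data.Fin.Subset using (Subset; _∈_; ∣_∣)
open import Data.Product using (Σ; ∃; ∃-syntax; _×_; _,_)
open import Data.Sum using (_⊎_)
open import Relation.Binary.PropositionalEquality using (_≡_)
open import Relation.Nullary using (¬_)
open import Function.Bundles using (_⇔_)

open import Data.Bool using (true)
open import Data.Empty using (⊥-elim)
open import Data.Fin using (zero; suc)
open import Data.Fin.Properties using (all?)
open import Data.Nat using (ℕ; _+_)
open import Data.Nat.Properties using () renaming (_≟_ to _≟ℕ_)
open import Data.Product using (proj₁; proj₂)
open import Data.Sum using (inj₁; inj₂; [_,_])
open import Data.Vec using (Vec; []; _∷_; lookup; map; zipWith; replicate; tabulate)
open import Data.Vec.Properties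
  using ( ≡-dec; ∷-injective; map-id; map-cong; lookup-map; lookup-zipWith
        ; lookup∘tabulate; []=⇒lookup; lookup⇒[]=)
open import Function.Base using (id; _∘_)
open import Function.Bundles using (mk⇔; Equivalence)
open import Level using (0ℓ)
open import Relation.Binary.Definitions using (DecidableEquality)
open import Relation.Binary.PropositionalEquality using (_≢_; refl; sym; trans; cong; cong₂; subst)
open import Relation.Nullary.Decidable
  using (Dec; yes; no; does; map′; ¬?; _×-dec_; _⊎-dec_; _→-dec_; from-yes)
open import Relation.Unary using (Pred; Decidable)

infix 4 _≟F_ _≟V_

_≟F_ : DecidableEquality F4
𝟎  ≟F 𝟎  = yes refl
𝟎  ≟F 𝟏  = no λ ()
𝟎  ≟F α  = no λ ()
𝟎  ≟F α² = no λ ()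
𝟏  ≟F 𝟎  = no λ ()
𝟏  ≟F 𝟏  = yes refl
𝟏  ≟F α  = no λ ()
𝟏  ≟F α² = no λ ()
α  ≟F 𝟎  = no λ ()
α  ≟F 𝟏  = no λ ()
α  ≟F α  = yes refl
α  ≟F α² = no λ ()
α² ≟F 𝟎  = no λ ()
α² ≟F 𝟏  = no λ ()
α² ≟F α  = no λ ()
α² ≟F α² = yes refl

_≟V_ : DecidableEquality V
_≟V_ = ≡-dec _≟F_

∀F4? : {P : Pred F4 0ℓ} → Decidable P → Dec (∀ x → P x)
∀F4? P? = map′ (λ { (p𝟎 , p𝟏 , pα , pα²) → λ { 𝟎 → p𝟎 ; 𝟏 → p𝟏 ; α → pα ; α² → pα² } })
               (λ p → p 𝟎 , p 𝟏 , p α , p α²)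
               (P? 𝟎 ×-dec P? 𝟏 ×-dec P? α ×-dec P? α²)

∃F4? : {P : Pred F4 0ℓ} → Decidable P → Dec (∃ P)
∃F4? P? = map′ [ (𝟎 ,_) , [ (𝟏 ,_) , [ (α ,_) , (α² ,_) ] ] ]
               (λ { (𝟎 , p) → inj₁ p ; (𝟏 , p) → inj₂ (inj₁ p)
                  ; (α , p) → inj₂ (inj₂ (inj₁ p)) ; (α² , p) → inj₂ (inj₂ (inj₂ p)) })
               (P? 𝟎 ⊎-dec P? 𝟏 ⊎-dec P? α ⊎-dec P? α²)

+-self : ∀ x → x +F x ≡ 𝟎
+-self = from-yes (∀F4? λ x → x +F x ≟F 𝟎)

+≡𝟎⇒≡ : ∀ x y → x +F y ≡ 𝟎 → x ≡ y
+≡𝟎⇒≡ = from-yes (∀F4? λ x → ∀F4? λ y → x +F y ≟F 𝟎 →-dec x ≟F y)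

+-identityʳ : ∀ x → x +F 𝟎 ≡ x
+-identityʳ = from-yes (∀F4? λ x → x +F 𝟎 ≟F x)

*-zeroʳ : ∀ x → x *F 𝟎 ≡ 𝟎
*-zeroʳ = from-yes (∀F4? λ x → x *F 𝟎 ≟F 𝟎)

*𝟎+*𝟏 : ∀ x y → x *F 𝟎 +F y *F 𝟏 ≡ y
*𝟎+*𝟏 = from-yes (∀F4? λ x → ∀F4? λ y → x *F 𝟎 +F y *F 𝟏 ≟F y)

*𝟏+*𝟎 : ∀ x y → x *F 𝟏 +F y *F 𝟎 ≡ x
*𝟏+*𝟎 = from-yes (∀F4? λ x → ∀F4? λ y → x *F 𝟏 +F y *F 𝟎 ≟F x)

*-comm-+-self : ∀ x y → x *F y +F y *F x ≡ 𝟎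
*-comm-+-self = from-yes (∀F4? λ x → ∀F4? λ y → x *F y +F y *F x ≟F 𝟎)

*-distrib-comb : ∀ c a b x y → c *F (a *F x +F b *F y) ≡ (c *F a) *F x +F (c *F b) *F y
*-distrib-comb = from-yes (∀F4? λ c → ∀F4? λ a → ∀F4? λ b → ∀F4? λ x → ∀F4? λ y →
  c *F (a *F x +F b *F y) ≟F (c *F a) *F x +F (c *F b) *F y)

+-comb : ∀ a b a′ b′ x y →
  (a *F x +F b *F y) +F (a′ *F x +F b′ *F y) ≡ (a +F a′) *F x +F (b +F b′) *F y
+-comb = from-yes (∀F4? λ a → ∀F4? λ b → ∀F4? λ a′ → ∀F4? λ b′ → ∀F4? λ x → ∀F4? λ y →
  (a *F x +F b *F y) +F (a′ *F x +F b′ *F y) ≟F (a +F a′) *F x +F (b +F b′) *F y)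

inv : F4 → F4
inv 𝟎  = 𝟎
inv 𝟏  = 𝟏
inv α  = α²
inv α² = α

inv-*ˡ : ∀ x → x ≢ 𝟎 → inv x *F x ≡ 𝟏
inv-*ˡ = from-yes (∀F4? λ x → ¬? (x ≟F 𝟎) →-dec inv x *F x ≟F 𝟏)

-- At length 5, lin a b u v is a • u ⊕ b • v by definition.
lin : ∀ {n} → F4 → F4 → Vec F4 n → Vec F4 n → Vec F4 n
lin a b u v = zipWith _+F_ (map (a *F_) u) (map (b *F_) v)

lookup-lin : ∀ {n} (j : Fin n) a b u v → lookup (lin a b u v) j ≡ a *F lookup u j +F b *F lookup v j
lookup-lin j a b u v =
  trans (lookup-zipWith _+F_ j (map (a *F_) u) (map (b *F_) v))
        (cong₂ _+F_ (lookup-map j (a *F_) u) (lookup-map j (b *F_) v))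

map-lin : ∀ {n} c a b (u v : Vec F4 n) → map (c *F_) (lin a b u v) ≡ lin (c *F a) (c *F b) u v
map-lin c a b []       []       = refl
map-lin c a b (x ∷ u) (y ∷ v) = cong₂ _∷_ (*-distrib-comb c a b x y) (map-lin c a b u v)

zipWith-lin : ∀ {n} a b a′ b′ (u v : Vec F4 n) →
  zipWith _+F_ (lin a b u v) (lin a′ b′ u v) ≡ lin (a +F a′) (b +F b′) u v
zipWith-lin a b a′ b′ []       []       = refl
zipWith-lin a b a′ b′ (x ∷ u) (y ∷ v) = cong₂ _∷_ (+-comb a b a′ b′ x y) (zipWith-lin a b a′ b′ u v)

map-𝟏* : ∀ {n} (x : Vec F4 n) → map (𝟏 *F_) x ≡ x
map-𝟏* x = trans (map-cong (λ _ → refl) x) (map-id x)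

lin-𝟏𝟎 : ∀ {n} (u v : Vec F4 n) → lin 𝟏 𝟎 u v ≡ u
lin-𝟏𝟎 []       []       = refl
lin-𝟏𝟎 (x ∷ u) (y ∷ v) = cong₂ _∷_ (+-identityʳ x) (lin-𝟏𝟎 u v)

zipWith-+≡replicate𝟎⇒≡ : ∀ {n} (x y : Vec F4 n) → zipWith _+F_ x y ≡ replicate n 𝟎 → x ≡ y
zipWith-+≡replicate𝟎⇒≡ []       []       _  = refl
zipWith-+≡replicate𝟎⇒≡ (x ∷ xs) (y ∷ ys) eq =
  cong₂ _∷_ (+≡𝟎⇒≡ x y (proj₁ (∷-injective eq)))
            (zipWith-+≡replicate𝟎⇒≡ xs ys (proj₂ (∷-injective eq)))

lookup₀₁≡𝟎⇒numZeros≢1 : ∀ {n} (x : Vec F4 (2 + n)) →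
  lookup x zero ≡ 𝟎 → lookup x (suc zero) ≡ 𝟎 → numZeros x ≢ 1
lookup₀₁≡𝟎⇒numZeros≢1 (.𝟎 ∷ .𝟎 ∷ _) refl refl ()

⊆-trans : {A B D : Sub} → A ⊆ B → B ⊆ D → A ⊆ D
⊆-trans A⊆B B⊆D x = B⊆D x ∘ A⊆B x

SameSet-sym : {A B : Sub} → SameSet A B → SameSet B A
SameSet-sym (A⊆B , B⊆A) = B⊆A , A⊆B

SameSet-trans : {A B D : Sub} → SameSet A B → SameSet B D → SameSet A D
SameSet-trans (A⊆B , B⊆A) (B⊆D , D⊆B) = ⊆-trans A⊆B B⊆D , ⊆-trans D⊆B B⊆A

∩-monoˡ : {A A′ B : Sub} → A ⊆ A′ → (A ∩ B) ⊆ (A′ ∩ B)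
∩-monoˡ A⊆A′ x (a , b) = A⊆A′ x a , b

∩-congˡ : {A A′ B : Sub} → SameSet A A′ → SameSet (A ∩ B) (A′ ∩ B)
∩-congˡ (A⊆A′ , A′⊆A) = ∩-monoˡ A⊆A′ , ∩-monoˡ A′⊆A

IsPoint-cong : {A B : Sub} → SameSet A B → IsPoint A → IsPoint B
IsPoint-cong A≈B (p , p≢0 , A≈p) = p , p≢0 , SameSet-trans (SameSet-sym A≈B) A≈p

Adjacent-congˡ : {M M′ N : Sub} → SameSet M M′ → Adjacent M N → Adjacent M′ N
Adjacent-congˡ M≈M′ (M≉N , M∩N-point) =
  M≉N ∘ SameSet-trans M≈M′ , IsPoint-cong (∩-congˡ M≈M′) M∩N-point

MeetsAllInNewPoints-cong : {M M′ : Sub} → SameSet M M′ →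
  MeetsAllInNewPoints M → MeetsAllInNewPoints M′
MeetsAllInNewPoints-cong M≈M′ meets j =
  IsPoint-cong (∩-congˡ M≈M′) (proj₁ (meets j)) , proj₂ (meets j) ∘ SameSet-trans (∩-congˡ M≈M′)

OnlySimplex : Sub → Set
OnlySimplex M = ∀ x → M x → x ≢ 0V → Simplex x

OnlySimplex-antitone : {M M′ : Sub} → M′ ⊆ M → OnlySimplex M → OnlySimplex M′
OnlySimplex-antitone M′⊆M simplex x = simplex x ∘ M′⊆M x

Incidence : Sub → Subset 5 → Set
Incidence M S = ∀ j → j ∈ S ⇔ (M ∩ H j) ⊆ C j

Incidence-cong : ∀ {M M′ S} → SameSet M M′ → Incidence M S → Incidence M′ S
Incidence-cong (M⊆M′ , M′⊆M) inc j = mk⇔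
  (λ j∈ → ⊆-trans (∩-monoˡ M′⊆M) (Equivalence.to (inc j) j∈))
  (λ M′⊆ → Equivalence.from (inc j) (⊆-trans (∩-monoˡ M⊆M′) M′⊆))

module _ {u v : V} where

  Span2-• : ∀ c {x} → Span2 u v x → Span2 u v (c • x)
  Span2-• c (a , b , refl) = c *F a , c *F b , map-lin c a b u v

  Span2-⊕ : ∀ {x y} → Span2 u v x → Span2 u v y → Span2 u v (x ⊕ y)
  Span2-⊕ (a , b , refl) (a′ , b′ , refl) = a +F a′ , b +F b′ , zipWith-lin a b a′ b′ u v

  Span2-⊆ : ∀ {u′ v′} → Span2 u v u′ → Span2 u v v′ → Span2 u′ v′ ⊆ Span2 u v
  Span2-⊆ u′∈ v′∈ x (a , b , refl) = Span2-⊕ (Span2-• a u′∈) (Span2-• b v′∈)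

  -- x ⊕ y lies on the line and vanishes at two coordinates, so it cannot be a nonzero vector.
  Span2-determined₀₁ : OnlySimplex (Span2 u v) → ∀ {x y} → Span2 u v x → Span2 u v y →
    lookup x zero ≡ lookup y zero → lookup x (suc zero) ≡ lookup y (suc zero) → x ≡ y
  Span2-determined₀₁ simplex {x} {y} x∈ y∈ x₀≡y₀ x₁≡y₁ with x ⊕ y ≟V 0V
  ... | yes x+y≡0 = zipWith-+≡replicate𝟎⇒≡ x y x+y≡0
  ... | no  x+y≢0 = ⊥-elim (lookup₀₁≡𝟎⇒numZeros≢1 (x ⊕ y) (vanishes x₀≡y₀) (vanishes x₁≡y₁)
                      (simplex _ (Span2-⊕ x∈ y∈) x+y≢0))
    where
    vanishes : ∀ {j} → lookup x j ≡ lookup y j → lookup (x ⊕ y) j ≡ 𝟎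
    vanishes {j} xⱼ≡yⱼ =
      trans (lookup-zipWith _+F_ j x y) (trans (cong (_+F lookup y j) xⱼ≡yⱼ) (+-self (lookup y j)))

  nonzero-vanishing-at : ∀ j → Independent u v → ∃[ p ] (Span2 u v p × p ≢ 0V × lookup p j ≡ 𝟎)
  nonzero-vanishing-at j independent with lookup u j ≟F 𝟎
  ... | yes uⱼ≡0 = u , (𝟏 , 𝟎 , sym (lin-𝟏𝟎 u v)) ,
                   (λ u≡0 → 𝟏≢𝟎 (proj₁ (independent 𝟏 𝟎 (trans (lin-𝟏𝟎 u v) u≡0)))) , uⱼ≡0
    where
    𝟏≢𝟎 : 𝟏 ≢ 𝟎
    𝟏≢𝟎 ()
  ... | no  uⱼ≢0 = lin vⱼ uⱼ u v , (vⱼ , uⱼ , refl) , (uⱼ≢0 ∘ proj₂ ∘ independent vⱼ uⱼ) ,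
                   trans (lookup-lin j vⱼ uⱼ u v) (*-comm-+-self vⱼ uⱼ)
    where
    uⱼ = lookup u j
    vⱼ = lookup v j

w₁ : F4 → F4 → F4 → V
w₁ a b c = 𝟎 ∷ 𝟏 ∷ a ∷ b ∷ c ∷ []

w₂ : F4 → F4 → F4 → V
w₂ d e f = 𝟏 ∷ 𝟎 ∷ d ∷ e ∷ f ∷ []

scale-to-w₁ : ∀ p → lookup p zero ≡ 𝟎 → lookup p (suc zero) ≢ 𝟎 →
  ∃[ a ] ∃[ b ] ∃[ c ] inv (lookup p (suc zero)) • p ≡ w₁ a b c
scale-to-w₁ (.𝟎 ∷ p₁ ∷ _ ∷ _ ∷ _ ∷ []) refl p₁≢0 =
  _ , _ , _ , cong₂ _∷_ (*-zeroʳ (inv p₁)) (cong₂ _∷_ (inv-*ˡ p₁ p₁≢0) refl)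

scale-to-w₂ : ∀ p → lookup p (suc zero) ≡ 𝟎 → lookup p zero ≢ 𝟎 →
  ∃[ d ] ∃[ e ] ∃[ f ] inv (lookup p zero) • p ≡ w₂ d e f
scale-to-w₂ (p₀ ∷ .𝟎 ∷ _ ∷ _ ∷ _ ∷ []) refl p₀≢0 =
  _ , _ , _ , cong₂ _∷_ (inv-*ˡ p₀ p₀≢0) (cong₂ _∷_ (*-zeroʳ (inv p₀)) refl)

Span2-w₁w₂ : ∀ {u v a b c d e f} → OnlySimplex (Span2 u v) →
  Span2 u v (w₁ a b c) → Span2 u v (w₂ d e f) → SameSet (Span2 u v) (Span2 (w₁ a b c) (w₂ d e f))
Span2-w₁w₂ {u} {v} {a} {b} {c} {d} {e} {f} simplex w₁∈ w₂∈ = ⊆w , Span2-⊆ w₁∈ w₂∈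
  where
  ⊆w : Span2 u v ⊆ Span2 (w₁ a b c) (w₂ d e f)
  ⊆w x x∈ = x₁ , x₀ , Span2-determined₀₁ simplex x∈ (Span2-⊆ w₁∈ w₂∈ _ (x₁ , x₀ , refl))
                        (sym (*𝟎+*𝟏 x₁ x₀)) (sym (*𝟏+*𝟎 x₁ x₀))
    where
    x₀ = lookup x zero
    x₁ = lookup x (suc zero)

normal-form : ∀ u v → SimplexLine u v →
  ∃[ a ] ∃[ b ] ∃[ c ] ∃[ d ] ∃[ e ] ∃[ f ] SameSet (Span2 u v) (Span2 (w₁ a b c) (w₂ d e f))
normal-form u v (independent , simplex)
  with nonzero-vanishing-at zero independent | nonzero-vanishing-at (suc zero) independent
... | p , p∈ , p≢0 , p₀≡0 | q , q∈ , q≢0 , q₁≡0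
  with scale-to-w₁ p p₀≡0 (λ p₁≡0 → lookup₀₁≡𝟎⇒numZeros≢1 p p₀≡0 p₁≡0 (simplex p p∈ p≢0))
     | scale-to-w₂ q q₁≡0 (λ q₀≡0 → lookup₀₁≡𝟎⇒numZeros≢1 q q₀≡0 q₁≡0 (simplex q q∈ q≢0))
... | a , b , c , p≈w₁ | d , e , f , q≈w₂ =
  a , b , c , d , e , f ,
  Span2-w₁w₂ simplex (subst (Span2 u v) p≈w₁ (Span2-• _ p∈)) (subst (Span2 u v) q≈w₂ (Span2-• _ q∈))

does-true⇔ : ∀ {A : Set} (a? : Dec A) → does a? ≡ true ⇔ A
does-true⇔ (yes a)  = mk⇔ (λ _ → a) (λ _ → refl)
does-true⇔ (no ¬a) = mk⇔ (λ ()) (⊥-elim ∘ ¬a)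

∈-tabulate-does : ∀ {n} {P : Pred (Fin n) 0ℓ} (P? : Decidable P) j → j ∈ tabulate (does ∘ P?) ⇔ P j
∈-tabulate-does P? j = mk⇔
  (λ j∈ → Equivalence.to (does-true⇔ (P? j)) (trans (sym (lookup∘tabulate _ j)) ([]=⇒lookup j∈)))
  (λ Pj → lookup⇒[]= j _ (trans (lookup∘tabulate _ j) (Equivalence.from (does-true⇔ (P? j)) Pj)))

Span1? : ∀ p → Decidable (Span1 p)
Span1? p x = ∃F4? λ c → x ≟V c • p

Span2? : ∀ u v → Decidable (Span2 u v)
Span2? u v x = ∃F4? λ a → ∃F4? λ b → x ≟V a • u ⊕ b • v

Span1-⊆? : ∀ {R} → Decidable R → ∀ p → Dec (Span1 p ⊆ R)
Span1-⊆? R? p = map′ (λ r x → λ { (c , refl) → r c }) (λ r c → r (c • p) (c , refl))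
                  (∀F4? λ c → R? (c • p))

Span2-⊆? : ∀ {R} → Decidable R → ∀ u v → Dec (Span2 u v ⊆ R)
Span2-⊆? R? u v = map′ (λ r x → λ { (a , b , refl) → r a b }) (λ r a b → r _ (a , b , refl))
                    (∀F4? λ a → ∀F4? λ b → R? (a • u ⊕ b • v))

Span2∩-⊆? : ∀ {Q R} → Decidable Q → Decidable R → ∀ u v → Dec ((Span2 u v ∩ Q) ⊆ R)
Span2∩-⊆? Q? R? u v = map′ (λ r x (m , q) → r x m q) (λ r x m q → r x (m , q))
                        (Span2-⊆? (λ x → Q? x →-dec R? x) u v)

IsPoint-Span2∩? : ∀ {Q} → Decidable Q → ∀ u v → Dec (IsPoint (Span2 u v ∩ Q))
-- The generator of a point contained in Span2 u v is itself one of the 16 combinations of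
-- u and v, so searching over them is complete.
IsPoint-Span2∩? {Q} Q? u v =
  map′ (λ (a , b , pt) → a • u ⊕ b • v , pt) witnessInSpan
       (∃F4? λ a → ∃F4? λ b → pointAt? (a • u ⊕ b • v))
  where
  A : Sub
  A = Span2 u v ∩ Q
  A? : Decidable A
  A? x = Span2? u v x ×-dec Q? x
  pointAt? : ∀ p → Dec (p ≢ 0V × SameSet A (Span1 p))
  pointAt? p = ¬? (p ≟V 0V) ×-dec Span2∩-⊆? Q? (Span1? p) u v ×-dec Span1-⊆? A? p
  witnessInSpan : IsPoint A → ∃[ a ] ∃[ b ] (a • u ⊕ b • v ≢ 0V × SameSet A (Span1 (a • u ⊕ b • v)))
  witnessInSpan (p , p≢0 , same) with proj₁ (proj₂ same p (𝟏 , sym (map-𝟏* p)))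
  ... | a , b , refl = a , b , p≢0 , same

H? : ∀ j → Decidable (H j)
H? j x = dot (h j) x ≟F 𝟎

C? : ∀ j → Decidable (C j)
C? j x = lookup x j ≟F 𝟎

HC? : ∀ j → Decidable (H j ∩ C j)
HC? j x = H? j x ×-dec C? j x

Is013 : ℕ → Set
Is013 k = k ≡ 0 ⊎ k ≡ 1 ⊎ k ≡ 3

incidence : V → V → Subset 5
incidence u v = tabulate λ j → does (Span2∩-⊆? (H? j) (C? j) u v)

incidence-Incidence : ∀ u v → Incidence (Span2 u v) (incidence u v)
incidence-Incidence u v = ∈-tabulate-does (λ j → Span2∩-⊆? (H? j) (C? j) u v)

-- The cardinality is the cheap alternative; placing it first makes the decision procedure
-- check adjacency and the meeting points only for the few lines where it fails.
Trichotomy : V → V → Set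
Trichotomy u v = OnlySimplex (Span2 u v) → ¬ SameSet (Span2 u v) L →
  Is013 ∣ incidence u v ∣ ⊎ Adjacent (Span2 u v) L ⊎ MeetsAllInNewPoints (Span2 u v)

trichotomy? : ∀ u v → Dec (Trichotomy u v)
trichotomy? u v = Span2-⊆? (λ x → ¬? (x ≟V 0V) →-dec numZeros x ≟ℕ 1) u v
       →-dec ¬? sameL?
       →-dec (is013? ∣ incidence u v ∣ ⊎-dec (¬? sameL? ×-dec IsPoint-Span2∩? (Span2? l₁ l₂) u v)
              ⊎-dec all? λ j → IsPoint-Span2∩? (HC? j) u v ×-dec ¬? (sameP? j))
  where
  sameL? : Dec (SameSet (Span2 u v) L)
  sameL? = Span2-⊆? (Span2? l₁ l₂) u v ×-dec Span2-⊆? (Span2? u v) l₁ l₂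
  sameP? : ∀ j → Dec (SameSet (Span2 u v ∩ (H j ∩ C j)) (P j))
  sameP? j = Span2∩-⊆? (HC? j) (λ x → Span2? l₁ l₂ x ×-dec C? j x) u v
       ×-dec Span2∩-⊆? (C? j) (λ x → Span2? u v x ×-dec HC? j x) l₁ l₂
  is013? : ∀ k → Dec (Is013 k)
  is013? k = k ≟ℕ 0 ⊎-dec k ≟ℕ 1 ⊎-dec k ≟ℕ 3

trichotomy-w₁w₂ : ∀ a b c d e f → Trichotomy (w₁ a b c) (w₂ d e f)
trichotomy-w₁w₂ = from-yes (∀F4? λ a → ∀F4? λ b → ∀F4? λ c → ∀F4? λ d → ∀F4? λ e → ∀F4? λ f →
  trichotomy? (w₁ a b c) (w₂ d e f))

Trichotomy-transfer : ∀ {u v w w′} → Trichotomy w w′ → SameSet (Span2 u v) (Span2 w w′) →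
  SimplexLine u v →
  ¬ SameSet (Span2 u v) L → ¬ Adjacent (Span2 u v) L → ¬ MeetsAllInNewPoints (Span2 u v) →
  ∃[ S ] (Incidence (Span2 u v) S × Is013 ∣ S ∣)
Trichotomy-transfer {u} {v} {w} {w′} trichotomy uv≈w (_ , simplex) ≉L ¬adjacent ¬meets =
  incidence w w′ , Incidence-cong w≈uv (incidence-Incidence w w′) ,
  [ id , [ ⊥-elim ∘ ¬adjacent ∘ Adjacent-congˡ w≈uv
         , ⊥-elim ∘ ¬meets ∘ MeetsAllInNewPoints-cong w≈uv ] ]
    (trichotomy (OnlySimplex-antitone (proj₁ w≈uv) simplex) (≉L ∘ SameSet-trans uv≈w))
  where
  w≈uv : SameSet (Span2 w w′) (Span2 u v)
  w≈uv = SameSet-sym uv≈w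

lemma7 : (u v : V) → SimplexLine u v →
         ¬ SameSet (Span2 u v) L → ¬ Adjacent (Span2 u v) L →
         ¬ MeetsAllInNewPoints (Span2 u v) →
         ∃[ S ] ((∀ (j : Fin 5) → (j ∈ S) ⇔ (((Span2 u v) ∩ H j) ⊆ C j))
                 × (∣ S ∣ ≡ 0 ⊎ ∣ S ∣ ≡ 1 ⊎ ∣ S ∣ ≡ 3))
lemma7 u v simplexLine with normal-form u v simplexLine
... | a , b , c , d , e , f , uv≈w =
  Trichotomy-transfer {w = w₁ a b c} {w′ = w₂ d e f} (trichotomy-w₁w₂ a b c d e f) uv≈w simplexLine
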